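{- Let $n\ge1$ and let $\Delta_1,\Delta_2\subset B_n$ be proper ideals (simplicial complexes on subsets of $[1,n]$ containing $\emptyset$ but not $[1,n]$) such that $f_i(\Delta_1)-f_{n-i}(\Delta_1)=f_i(\Delta_2)-f_{n-i}(\Delta_2)$ for all $0\le i\le n$. Then $f_j(\mathrm{Bier}(\Delta_1))=f_j(\mathrm{Bier}(\Delta_2))$ for all $j$; that is, the face numbers of $\mathrm{Bier}(\Delta)$ depend only on $n$ and the differences $f_i(\Delta)-f_{n-i}(\Delta)$.
   Context: $f_i(\Delta)$ is the number of sets of cardinality $i$ in $\Delta$; $f_j(\Gamma)$ is the number of faces of cardinality $j$ of a simplicial complex $\Gamma$. The Bier sphere $\mathrm{Bier}(\Delta)$ is the simplicial complex on the vertex set $\{v_i: \{i\}\in\Delta\}\cup\{w_j: [1,n]\setminus\{j\}\notin\Delta\}$ whose faces are the sets $\{v_i: i\in B\}\cup\{w_j: j\in[1,n]\setminus C\}$ for all $B\subseteq C\subseteq[1,n]$ with $B\in\Delta$, $C\notin\Delta$. -}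

module Defs where

open import Data.Bool using (Bool; true; false; _∧_; not; T)
open import Data.Nat using (ℕ; zero; suc; _≡ᵇ_; _+_)
open import Data.List using (List; []; _∷_; _++_; map; filter; length)
open import Data.Vec using ([]; _∷_)
open import Data.Fin.Subset using (Subset; _⊆_; ∣_∣; ∁; _∩_; ⊥; ⊤)
open import Data.Product using (_×_; _,_)
open import Relation.Binary.PropositionalEquality using (_≡_)
open import Relation.Nullary.Decidable using (Dec; yes; no)
open import Data.Bool.Properties using (T?)

Family : ℕ → Set
Family n = Subset n → Bool

record IsProperIdeal {n : ℕ} (Δ : Family n) : Set where
  field
    down-closed : ∀ (A B : Subset n) → A ⊆ B → Δ B ≡ true → Δ A ≡ true
    has-empty   : Δ ⊥ ≡ true
    no-full     : Δ ⊤ ≡ false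

allSubsets : (n : ℕ) → List (Subset n)
allSubsets zero = [] ∷ []
allSubsets (suc n) = map (true ∷_) (allSubsets n) ++ map (false ∷_) (allSubsets n)

count : {A : Set} → (A → Bool) → List A → ℕ
count p [] = 0
count p (x ∷ xs) with p x
... | true  = suc (count p xs)
... | false = count p xs

fΔ : {n : ℕ} → ℕ → Family n → ℕ
fΔ {n} i Δ = count (λ S → Δ S ∧ (∣ S ∣ ≡ᵇ i)) (allSubsets n)

-- Its vertex set is contained in the disjoint union of two
-- copies {v_i} and {w_j} of [1,n]; a set of vertices is encoded as a pair
-- (X , Y) with X = {i : v_i in the set}, Y = {j : w_j in the set}.
-- (X , Y) is a face iff X = B, Y = [1,n] \ C for some B ⊆ C with B ∈ Δ,
-- C ∉ Δ, i.e. iff X ∈ Δ, ∁ Y ∉ Δ and X ∩ Y = ∅ (then B = X, C = ∁ Y are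
-- uniquely determined).
isBierFace : {n : ℕ} → Family n → Subset n × Subset n → Bool
isBierFace Δ (X , Y) = Δ X ∧ not (Δ (∁ Y)) ∧ (∣ X ∩ Y ∣ ≡ᵇ 0)

allPairs : (n : ℕ) → List (Subset n × Subset n)
allPairs n = Data.List.concatMap (λ X → map (X ,_) (allSubsets n)) (allSubsets n)

fBier : {n : ℕ} → ℕ → Family n → ℕ
fBier {n} j Δ = count (λ { (X , Y) → isBierFace Δ (X , Y) ∧ (∣ X ∣ + ∣ Y ∣ ≡ᵇ j) }) (allPairs n)

{-# OPTIONS --safe #-}
module Submission where

-- Fix j and consider the pairs (X , Y) of disjoint sets with ∣X∣ + ∣Y∣ = j.  As X ⊆ ∁ Y and
-- Δ is down-closed, the pairs with X ∈ Δ are the Bier faces together with the pairs with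
-- ∁ Y ∈ Δ.  The number of Y completing a given X is C(n − ∣X∣, j − ∣X∣), so grouping both
-- kinds of pairs by cardinality (using ∣∁ Y∣ = n − ∣Y∣ for the second) gives
--   f_j(Bier Δ) + Σᵢ f_{n−i}(Δ) C(n−i, j−i) = Σᵢ f_i(Δ) C(n−i, j−i),
-- in which Δ enters only through the differences f_i(Δ) − f_{n−i}(Δ).

open import Defs
open import Data.Nat using (ℕ; _≤_; _∸_)
open import Data.Integer using (+_; _-_)
open import Relation.Binary.PropositionalEquality using (_≡_)

open import Data.Bool using (Bool; true; false; _∧_; not)
open import Data.Fin.Subset using (Subset; _⊆_; ∣_∣; ∁; _∩_)
open import Data.Fin.Subset.Properties using (∣p∣≤n; ∣∁p∣≡n∸∣p∣; ∩-comm)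
import Data.Integer as ℤ
open import Data.Integer.Properties using (+-injective)
open import Data.Integer.Tactic.RingSolver using (solve-∀)
open import Data.List using (List; []; _∷_; _++_; [_]; map; concatMap; upTo)
open import Data.List.Membership.Propositional using (_∈_)
open import Data.List.Membership.Propositional.Properties using (∈-upTo⁻)
open import Data.List.Properties using (map-++; map-cong; map-cong-local; map-∘; upTo-∷ʳ)
import Data.List.Relation.Unary.All as All
open import Data.Nat using (zero; suc; _+_; _*_; _<_; _≡ᵇ_; _≟_; s≤s)
open import Data.Nat.ListAction using (sum)
open import Data.Nat.ListAction.Properties using (sum-++)
open import Data.Nat.Properties
  using (+-commutativeSemigroup; +-comm; +-assoc; +-identityʳ; *-assoc; *-zeroʳ; *-distribˡ-+; *-distribʳ-+;
         +-cancelʳ-≡; ∸-cancelˡ-≡; ≤-refl; ≤-pred; <⇒≤; >⇒≢; ≤∧≢⇒<)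
open import Data.Product using (_,_)
open import Data.Vec using ([]; _∷_)
open import Data.Vec.Base using (here; there)
open import Function using (_∘_; mk⇔)
open import Relation.Binary.PropositionalEquality
  using (_≢_; _≗_; refl; sym; trans; cong; cong₂; module ≡-Reasoning)
open import Relation.Nullary.Decidable using (yes; no; does-⇔; dec-true; dec-false)
open import Algebra.Properties.CommutativeSemigroup +-commutativeSemigroup using (interchange)

open ≡-Reasoning

𝟙 : Bool → ℕ
𝟙 true  = 1
𝟙 false = 0

𝟙-∧ : ∀ a b → 𝟙 (a ∧ b) ≡ 𝟙 a * 𝟙 b
𝟙-∧ true  b = sym (+-identityʳ (𝟙 b))
𝟙-∧ false b = refl

≡ᵇ-refl : ∀ n → (n ≡ᵇ n) ≡ true
≡ᵇ-refl n = dec-true (n ≟ n) refl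

≢⇒≡ᵇ-false : ∀ {m n} → m ≢ n → (m ≡ᵇ n) ≡ false
≢⇒≡ᵇ-false {m} {n} = dec-false (m ≟ n)

∑ : {A : Set} → List A → (A → ℕ) → ℕ
∑ xs f = sum (map f xs)

module _ {A : Set} where

  ∑-cong : ∀ {f g : A → ℕ} → f ≗ g → ∀ xs → ∑ xs f ≡ ∑ xs g
  ∑-cong f≗g xs = cong sum (map-cong f≗g xs)

  ∑-cong-local : ∀ xs {f g : A → ℕ} → (∀ {x} → x ∈ xs → f x ≡ g x) → ∑ xs f ≡ ∑ xs g
  ∑-cong-local xs eq = cong sum (map-cong-local (All.tabulate eq))

  ∑-++ : ∀ (xs ys : List A) f → ∑ (xs ++ ys) f ≡ ∑ xs f + ∑ ys f
  ∑-++ xs ys f = trans (cong sum (map-++ f xs ys)) (sum-++ (map f xs) (map f ys))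

  ∑-zero : ∀ (xs : List A) → ∑ xs (λ _ → 0) ≡ 0
  ∑-zero []       = refl
  ∑-zero (x ∷ xs) = ∑-zero xs

  ∑-+ : ∀ (xs : List A) f g → ∑ xs (λ x → f x + g x) ≡ ∑ xs f + ∑ xs g
  ∑-+ []       f g = refl
  ∑-+ (x ∷ xs) f g =
    trans (cong (_+_ (f x + g x)) (∑-+ xs f g)) (interchange (f x) (g x) (∑ xs f) (∑ xs g))

  ∑-*ˡ : ∀ c (xs : List A) f → ∑ xs (λ x → c * f x) ≡ c * ∑ xs f
  ∑-*ˡ c []       f = sym (*-zeroʳ c)
  ∑-*ˡ c (x ∷ xs) f =
    trans (cong (_+_ (c * f x)) (∑-*ˡ c xs f)) (sym (*-distribˡ-+ c (f x) (∑ xs f)))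

  ∑-*ʳ : ∀ c (xs : List A) f → ∑ xs (λ x → f x * c) ≡ ∑ xs f * c
  ∑-*ʳ c []       f = refl
  ∑-*ʳ c (x ∷ xs) f =
    trans (cong (_+_ (f x * c)) (∑-*ʳ c xs f)) (sym (*-distribʳ-+ c (f x) (∑ xs f)))

  ∑-*ʳ-cross : ∀ (xs : List A) (w a b c d : A → ℕ) →
    (∀ {x} → x ∈ xs → a x + b x ≡ c x + d x) →
    ∑ xs (λ x → a x * w x) + ∑ xs (λ x → b x * w x) ≡ ∑ xs (λ x → c x * w x) + ∑ xs (λ x → d x * w x)
  ∑-*ʳ-cross xs w a b c d eq = begin
    ∑ xs (λ x → a x * w x) + ∑ xs (λ x → b x * w x)   ≡⟨ ∑-+ xs _ _ ⟨
    ∑ xs (λ x → a x * w x + b x * w x)                 ≡⟨ ∑-cong-local xs cross ⟩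
    ∑ xs (λ x → c x * w x + d x * w x)                 ≡⟨ ∑-+ xs _ _ ⟩
    ∑ xs (λ x → c x * w x) + ∑ xs (λ x → d x * w x)   ∎
    where
    cross : ∀ {x} → x ∈ xs → a x * w x + b x * w x ≡ c x * w x + d x * w x
    cross {x} x∈xs = begin
      a x * w x + b x * w x   ≡⟨ *-distribʳ-+ (w x) (a x) (b x) ⟨
      (a x + b x) * w x       ≡⟨ cong (_* w x) (eq x∈xs) ⟩
      (c x + d x) * w x       ≡⟨ *-distribʳ-+ (w x) (c x) (d x) ⟩
      c x * w x + d x * w x   ∎

  count≡∑𝟙 : ∀ (p : A → Bool) xs → count p xs ≡ ∑ xs (𝟙 ∘ p)
  count≡∑𝟙 p []       = refl
  count≡∑𝟙 p (x ∷ xs) with p x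
  ... | true  = cong suc (count≡∑𝟙 p xs)
  ... | false = count≡∑𝟙 p xs

  count-cong : ∀ {p q : A → Bool} → p ≗ q → ∀ xs → count p xs ≡ count q xs
  count-cong {p} {q} p≗q xs = begin
    count p xs       ≡⟨ count≡∑𝟙 p xs ⟩
    ∑ xs (𝟙 ∘ p)     ≡⟨ ∑-cong (cong 𝟙 ∘ p≗q) xs ⟩
    ∑ xs (𝟙 ∘ q)     ≡⟨ count≡∑𝟙 q xs ⟨
    count q xs       ∎

  count-false : ∀ (xs : List A) → count (λ _ → false) xs ≡ 0
  count-false []       = refl
  count-false (x ∷ xs) = count-false xs

module _ {A B : Set} where

  ∑-map : ∀ (g : A → B) xs f → ∑ (map g xs) f ≡ ∑ xs (f ∘ g)
  ∑-map g xs f = cong sum (sym (map-∘ xs))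

  ∑-concatMap : ∀ (g : A → List B) xs f → ∑ (concatMap g xs) f ≡ ∑ xs (λ x → ∑ (g x) f)
  ∑-concatMap g []       f = refl
  ∑-concatMap g (x ∷ xs) f =
    trans (∑-++ (g x) (concatMap g xs) f) (cong (_+_ (∑ (g x) f)) (∑-concatMap g xs f))

  ∑-comm : ∀ xs ys (f : A → B → ℕ) → ∑ xs (λ x → ∑ ys (f x)) ≡ ∑ ys (λ y → ∑ xs (λ x → f x y))
  ∑-comm []       ys f = sym (∑-zero ys)
  ∑-comm (x ∷ xs) ys f =
    trans (cong (_+_ (∑ ys (f x))) (∑-comm xs ys f)) (sym (∑-+ ys (f x) (λ y → ∑ xs (λ x → f x y))))

  ∑-𝟙*count : ∀ xs ys (b : A → Bool) (p : A → B → Bool) →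
    ∑ xs (λ x → 𝟙 (b x) * count (p x) ys) ≡ ∑ xs (λ x → ∑ ys (λ y → 𝟙 (b x ∧ p x y)))
  ∑-𝟙*count xs ys b p = ∑-cong (λ x → begin
    𝟙 (b x) * count (p x) ys                ≡⟨ cong (𝟙 (b x) *_) (count≡∑𝟙 (p x) ys) ⟩
    𝟙 (b x) * ∑ ys (𝟙 ∘ p x)                ≡⟨ ∑-*ˡ (𝟙 (b x)) ys (𝟙 ∘ p x) ⟨
    ∑ ys (λ y → 𝟙 (b x) * 𝟙 (p x y))        ≡⟨ ∑-cong (λ y → 𝟙-∧ (b x) (p x y)) ys ⟨
    ∑ ys (λ y → 𝟙 (b x ∧ p x y))            ∎) xs

∑-upTo-suc : ∀ m (f : ℕ → ℕ) → ∑ (upTo (suc m)) f ≡ ∑ (upTo m) f + f m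
∑-upTo-suc m f = begin
  ∑ (upTo (suc m)) f          ≡⟨ cong (λ is → ∑ is f) (upTo-∷ʳ m) ⟨
  ∑ (upTo m ++ [ m ]) f       ≡⟨ ∑-++ (upTo m) [ m ] f ⟩
  ∑ (upTo m) f + (f m + 0)    ≡⟨ cong (_+_ (∑ (upTo m) f)) (+-identityʳ (f m)) ⟩
  ∑ (upTo m) f + f m          ∎

∑-upTo-δ-outside : ∀ {m k} (f : ℕ → ℕ) → m ≤ k → ∑ (upTo m) (λ i → 𝟙 (k ≡ᵇ i) * f i) ≡ 0
∑-upTo-δ-outside {zero}  f _ = refl
∑-upTo-δ-outside {suc m} {k} f m<k
  rewrite ∑-upTo-suc m (λ i → 𝟙 (k ≡ᵇ i) * f i)
        | ∑-upTo-δ-outside {m} f (<⇒≤ m<k)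
        | ≢⇒≡ᵇ-false (>⇒≢ m<k) = refl

∑-upTo-δ : ∀ {m k} (f : ℕ → ℕ) → k < m → ∑ (upTo m) (λ i → 𝟙 (k ≡ᵇ i) * f i) ≡ f k
∑-upTo-δ {suc m} {k} f (s≤s k≤m) with k ≟ m
... | yes refl
  rewrite ∑-upTo-suc k (λ i → 𝟙 (k ≡ᵇ i) * f i)
        | ∑-upTo-δ-outside f (≤-refl {k})
        | ≡ᵇ-refl k = +-identityʳ (f k)
... | no k≢m
  rewrite ∑-upTo-suc m (λ i → 𝟙 (k ≡ᵇ i) * f i)
        | ∑-upTo-δ f (≤∧≢⇒< k≤m k≢m)
        | ≢⇒≡ᵇ-false k≢m = +-identityʳ (f k)

∑-by-fibres : ∀ {A : Set} {m} (p : A → Bool) (κ : A → ℕ) (ψ : ℕ → ℕ) xs → (∀ x → κ x < m) →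
  ∑ xs (λ x → 𝟙 (p x) * ψ (κ x)) ≡ ∑ (upTo m) (λ i → count (λ x → p x ∧ (κ x ≡ᵇ i)) xs * ψ i)
∑-by-fibres {m = m} p κ ψ xs κ<m = begin
  ∑ xs (λ x → 𝟙 (p x) * ψ (κ x))
    ≡⟨ ∑-cong (λ x → cong (𝟙 (p x) *_) (∑-upTo-δ ψ (κ<m x))) xs ⟨
  ∑ xs (λ x → 𝟙 (p x) * ∑ (upTo m) (λ i → 𝟙 (κ x ≡ᵇ i) * ψ i))
    ≡⟨ ∑-cong (λ x → ∑-*ˡ (𝟙 (p x)) (upTo m) (λ i → 𝟙 (κ x ≡ᵇ i) * ψ i)) xs ⟨
  ∑ xs (λ x → ∑ (upTo m) (λ i → 𝟙 (p x) * (𝟙 (κ x ≡ᵇ i) * ψ i)))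
    ≡⟨ ∑-comm xs (upTo m) _ ⟩
  ∑ (upTo m) (λ i → ∑ xs (λ x → 𝟙 (p x) * (𝟙 (κ x ≡ᵇ i) * ψ i)))
    ≡⟨ ∑-cong (λ i → ∑-cong (λ x → merge-indicators (p x) (κ x ≡ᵇ i) (ψ i)) xs) (upTo m) ⟩
  ∑ (upTo m) (λ i → ∑ xs (λ x → 𝟙 (p x ∧ (κ x ≡ᵇ i)) * ψ i))
    ≡⟨ ∑-cong (λ i → ∑-*ʳ (ψ i) xs (λ x → 𝟙 (p x ∧ (κ x ≡ᵇ i)))) (upTo m) ⟩
  ∑ (upTo m) (λ i → ∑ xs (λ x → 𝟙 (p x ∧ (κ x ≡ᵇ i))) * ψ i)
    ≡⟨ ∑-cong (λ i → cong (_* ψ i) (count≡∑𝟙 (λ x → p x ∧ (κ x ≡ᵇ i)) xs)) (upTo m) ⟨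
  ∑ (upTo m) (λ i → count (λ x → p x ∧ (κ x ≡ᵇ i)) xs * ψ i) ∎
  where
  merge-indicators : ∀ a b c → 𝟙 a * (𝟙 b * c) ≡ 𝟙 (a ∧ b) * c
  merge-indicators a b c = trans (sym (*-assoc (𝟙 a) (𝟙 b) c)) (cong (_* c) (sym (𝟙-∧ a b)))

count-allSubsets-suc : ∀ n (p : Subset (suc n) → Bool) →
  count p (allSubsets (suc n)) ≡ count (p ∘ (true ∷_)) (allSubsets n) + count (p ∘ (false ∷_)) (allSubsets n)
count-allSubsets-suc n p = begin
  count p (allSubsets (suc n))
    ≡⟨ count≡∑𝟙 p (allSubsets (suc n)) ⟩
  ∑ (map (true ∷_) (allSubsets n) ++ map (false ∷_) (allSubsets n)) (𝟙 ∘ p)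
    ≡⟨ ∑-++ (map (true ∷_) (allSubsets n)) _ (𝟙 ∘ p) ⟩
  ∑ (map (true ∷_) (allSubsets n)) (𝟙 ∘ p) + ∑ (map (false ∷_) (allSubsets n)) (𝟙 ∘ p)
    ≡⟨ cong₂ _+_ (∑-map (true ∷_) (allSubsets n) (𝟙 ∘ p)) (∑-map (false ∷_) (allSubsets n) (𝟙 ∘ p)) ⟩
  ∑ (allSubsets n) (𝟙 ∘ p ∘ (true ∷_)) + ∑ (allSubsets n) (𝟙 ∘ p ∘ (false ∷_))
    ≡⟨ cong₂ _+_ (count≡∑𝟙 (p ∘ (true ∷_)) (allSubsets n)) (count≡∑𝟙 (p ∘ (false ∷_)) (allSubsets n)) ⟨
  count (p ∘ (true ∷_)) (allSubsets n) + count (p ∘ (false ∷_)) (allSubsets n) ∎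

count-∁ : ∀ n (p : Subset n → Bool) → count (p ∘ ∁) (allSubsets n) ≡ count p (allSubsets n)
count-∁ zero  p with p []
... | true  = refl
... | false = refl
count-∁ (suc n) p = begin
  count (p ∘ ∁) (allSubsets (suc n))
    ≡⟨ count-allSubsets-suc n (p ∘ ∁) ⟩
  count (p ∘ (false ∷_) ∘ ∁) (allSubsets n) + count (p ∘ (true ∷_) ∘ ∁) (allSubsets n)
    ≡⟨ cong₂ _+_ (count-∁ n (p ∘ (false ∷_))) (count-∁ n (p ∘ (true ∷_))) ⟩
  count (p ∘ (false ∷_)) (allSubsets n) + count (p ∘ (true ∷_)) (allSubsets n)
    ≡⟨ +-comm (count (p ∘ (false ∷_)) (allSubsets n)) _ ⟩
  count (p ∘ (true ∷_)) (allSubsets n) + count (p ∘ (false ∷_)) (allSubsets n)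
    ≡⟨ count-allSubsets-suc n p ⟨
  count p (allSubsets (suc n)) ∎

count-disjoint : ∀ {n} (P : ℕ → Bool) (X : Subset n) →
  count (λ Y → (∣ X ∩ Y ∣ ≡ᵇ 0) ∧ P ∣ Y ∣) (allSubsets n) ≡ count (P ∘ ∣_∣) (allSubsets ∣ ∁ X ∣)
count-disjoint P []          with P 0
... | true  = refl
... | false = refl
count-disjoint {suc n} P (true ∷ X) =
  trans (count-allSubsets-suc n (λ Y → (∣ (true ∷ X) ∩ Y ∣ ≡ᵇ 0) ∧ P ∣ Y ∣))
        (cong₂ _+_ (count-false (allSubsets n)) (count-disjoint P X))
count-disjoint {suc n} P (false ∷ X) =
  trans (count-allSubsets-suc n (λ Y → (∣ (false ∷ X) ∩ Y ∣ ≡ᵇ 0) ∧ P ∣ Y ∣))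
        (trans (cong₂ _+_ (count-disjoint (P ∘ suc) X) (count-disjoint P X))
               (sym (count-allSubsets-suc ∣ ∁ X ∣ (P ∘ ∣_∣))))

disjoint⇒⊆∁ : ∀ {n} (X Y : Subset n) → (∣ X ∩ Y ∣ ≡ᵇ 0) ≡ true → X ⊆ ∁ Y
disjoint⇒⊆∁ (true  ∷ X) (true  ∷ Y) ()
disjoint⇒⊆∁ (true  ∷ X) (false ∷ Y) _    here        = here
disjoint⇒⊆∁ (true  ∷ X) (false ∷ Y) X∩Y  (there x∈X) = there (disjoint⇒⊆∁ X Y X∩Y x∈X)
disjoint⇒⊆∁ (false ∷ X) (_     ∷ Y) X∩Y  (there x∈X) = there (disjoint⇒⊆∁ X Y X∩Y x∈X)

DownClosed : ∀ {n} → Family n → Set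
DownClosed {n} Δ = ∀ (A B : Subset n) → A ⊆ B → Δ B ≡ true → Δ A ≡ true

completes : ∀ {n} → ℕ → Subset n → Subset n → Bool
completes j X Y = (∣ X ∩ Y ∣ ≡ᵇ 0) ∧ (∣ X ∣ + ∣ Y ∣ ≡ᵇ j)

completes-sym : ∀ {n} j (X Y : Subset n) → completes j X Y ≡ completes j Y X
completes-sym j X Y =
  cong₂ (λ k l → (k ≡ᵇ 0) ∧ (l ≡ᵇ j)) (cong ∣_∣ (∩-comm X Y)) (+-comm ∣ X ∣ ∣ Y ∣)

completions : ∀ {n} → ℕ → Subset n → ℕ
completions {n} j X = count (completes j X) (allSubsets n)

-- C(n ∸ i, j ∸ i) when i ≤ j, and 0 otherwise.
extensions : ℕ → ℕ → ℕ → ℕ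
extensions n i j = count (λ Z → i + ∣ Z ∣ ≡ᵇ j) (allSubsets (n ∸ i))

completions≡extensions : ∀ {n} j (X : Subset n) → completions j X ≡ extensions n ∣ X ∣ j
completions≡extensions j X =
  trans (count-disjoint (λ k → ∣ X ∣ + k ≡ᵇ j) X)
        (cong (λ m → count (λ Z → ∣ X ∣ + ∣ Z ∣ ≡ᵇ j) (allSubsets m)) (∣∁p∣≡n∸∣p∣ X))

𝟙-split : ∀ a b c s → (c ≡ true → b ≡ true → a ≡ true) →
  𝟙 ((a ∧ not b ∧ c) ∧ s) + 𝟙 (b ∧ c ∧ s) ≡ 𝟙 (a ∧ c ∧ s)
𝟙-split true  true  c     s _ = refl
𝟙-split true  false c     s _ = +-identityʳ (𝟙 (c ∧ s))
𝟙-split false false c     s _ = refl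
𝟙-split false true  false s _ = refl
𝟙-split false true  true  s c⇒b⇒a with c⇒b⇒a refl refl
... | ()

fBier≡∑∑ : ∀ {n} j (Δ : Family n) → fBier j Δ ≡
  ∑ (allSubsets n) (λ X → ∑ (allSubsets n) (λ Y → 𝟙 (isBierFace Δ (X , Y) ∧ (∣ X ∣ + ∣ Y ∣ ≡ᵇ j))))
fBier≡∑∑ {n} j Δ =
  trans (count≡∑𝟙 _ (allPairs n))
        (trans (∑-concatMap (λ X → map (X ,_) (allSubsets n)) (allSubsets n) _)
               (∑-cong (λ X → ∑-map (X ,_) (allSubsets n) _) (allSubsets n)))

bier-pairs : ∀ {n} {Δ : Family n} → DownClosed Δ → ∀ j →
  fBier j Δ + ∑ (allSubsets n) (λ Y → 𝟙 (Δ (∁ Y)) * completions j Y)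
    ≡ ∑ (allSubsets n) (λ X → 𝟙 (Δ X) * completions j X)
bier-pairs {n} {Δ} closed j = begin
  fBier j Δ + ∑ all (λ Y → 𝟙 (Δ (∁ Y)) * completions j Y)
    ≡⟨ cong₂ _+_ (fBier≡∑∑ j Δ) (∑-𝟙*count all all (Δ ∘ ∁) (completes j)) ⟩
  ∑ all (λ X → ∑ all (face X)) + ∑ all (λ Y → ∑ all (λ X → 𝟙 (Δ (∁ Y) ∧ completes j Y X)))
    ≡⟨ cong (_+_ (∑ all (λ X → ∑ all (face X)))) (∑-comm all all _) ⟩
  ∑ all (λ X → ∑ all (face X)) + ∑ all (λ X → ∑ all (λ Y → 𝟙 (Δ (∁ Y) ∧ completes j Y X)))
    ≡⟨ ∑-+ all _ _ ⟨
  ∑ all (λ X → ∑ all (face X) + ∑ all (λ Y → 𝟙 (Δ (∁ Y) ∧ completes j Y X)))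
    ≡⟨ ∑-cong (λ X → ∑-+ all (face X) _) all ⟨
  ∑ all (λ X → ∑ all (λ Y → face X Y + 𝟙 (Δ (∁ Y) ∧ completes j Y X)))
    ≡⟨ ∑-cong (λ X → ∑-cong (split X) all) all ⟩
  ∑ all (λ X → ∑ all (λ Y → 𝟙 (Δ X ∧ completes j X Y)))
    ≡⟨ ∑-𝟙*count all all Δ (completes j) ⟨
  ∑ all (λ X → 𝟙 (Δ X) * completions j X) ∎
  where
  all = allSubsets n
  face : Subset n → Subset n → ℕ
  face X Y = 𝟙 (isBierFace Δ (X , Y) ∧ (∣ X ∣ + ∣ Y ∣ ≡ᵇ j))
  split : ∀ X Y → face X Y + 𝟙 (Δ (∁ Y) ∧ completes j Y X) ≡ 𝟙 (Δ X ∧ completes j X Y)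
  split X Y = trans (cong (λ b → face X Y + 𝟙 (Δ (∁ Y) ∧ b)) (completes-sym j Y X))
    (𝟙-split (Δ X) (Δ (∁ Y)) (∣ X ∩ Y ∣ ≡ᵇ 0) (∣ X ∣ + ∣ Y ∣ ≡ᵇ j)
      (λ disjoint → closed X (∁ Y) (disjoint⇒⊆∁ X Y disjoint)))

count-∁-cardinality : ∀ {n} (Δ : Family n) {i} → i ≤ n →
  count (λ Y → Δ (∁ Y) ∧ (∣ Y ∣ ≡ᵇ i)) (allSubsets n) ≡ fΔ (n ∸ i) Δ
count-∁-cardinality {n} Δ {i} i≤n = begin
  count (λ Y → Δ (∁ Y) ∧ (∣ Y ∣ ≡ᵇ i)) (allSubsets n)
    ≡⟨ count-cong (λ Y → cong (Δ (∁ Y) ∧_) (complement-test Y)) (allSubsets n) ⟩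
  count (λ Y → Δ (∁ Y) ∧ (∣ ∁ Y ∣ ≡ᵇ n ∸ i)) (allSubsets n)
    ≡⟨ count-∁ n (λ C → Δ C ∧ (∣ C ∣ ≡ᵇ n ∸ i)) ⟩
  fΔ (n ∸ i) Δ ∎
  where
  complement-test : ∀ Y → (∣ Y ∣ ≡ᵇ i) ≡ (∣ ∁ Y ∣ ≡ᵇ n ∸ i)
  complement-test Y rewrite ∣∁p∣≡n∸∣p∣ Y =
    does-⇔ (mk⇔ (cong (n ∸_)) (∸-cancelˡ-≡ (∣p∣≤n Y) i≤n)) (∣ Y ∣ ≟ i) (n ∸ ∣ Y ∣ ≟ n ∸ i)

bier-face-identity : ∀ {n} {Δ : Family n} → DownClosed Δ → ∀ j →
  fBier j Δ + ∑ (upTo (suc n)) (λ i → fΔ (n ∸ i) Δ * extensions n i j)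
    ≡ ∑ (upTo (suc n)) (λ i → fΔ i Δ * extensions n i j)
bier-face-identity {n} {Δ} closed j = begin
  fBier j Δ + ∑ (upTo (suc n)) (λ i → fΔ (n ∸ i) Δ * extensions n i j)
    ≡⟨ cong (_+_ (fBier j Δ)) (sym co-faces) ⟩
  fBier j Δ + ∑ (allSubsets n) (λ Y → 𝟙 (Δ (∁ Y)) * completions j Y)
    ≡⟨ bier-pairs closed j ⟩
  ∑ (allSubsets n) (λ X → 𝟙 (Δ X) * completions j X)
    ≡⟨ by-cardinality Δ ⟩
  ∑ (upTo (suc n)) (λ i → fΔ i Δ * extensions n i j) ∎
  where
  by-cardinality : ∀ (p : Subset n → Bool) →
    ∑ (allSubsets n) (λ X → 𝟙 (p X) * completions j X)
      ≡ ∑ (upTo (suc n)) (λ i → count (λ X → p X ∧ (∣ X ∣ ≡ᵇ i)) (allSubsets n) * extensions n i j)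
  by-cardinality p =
    trans (∑-cong (λ X → cong (𝟙 (p X) *_) (completions≡extensions j X)) (allSubsets n))
          (∑-by-fibres p ∣_∣ (λ i → extensions n i j) (allSubsets n) (λ X → s≤s (∣p∣≤n X)))
  co-faces : ∑ (allSubsets n) (λ Y → 𝟙 (Δ (∁ Y)) * completions j Y)
               ≡ ∑ (upTo (suc n)) (λ i → fΔ (n ∸ i) Δ * extensions n i j)
  co-faces = trans (by-cardinality (Δ ∘ ∁)) (∑-cong-local (upTo (suc n)) λ {i} i∈ →
    cong (_* extensions n i j) (count-∁-cardinality Δ (≤-pred (∈-upTo⁻ i∈))))

m-n≡p-q⇒m+q≡p+n : ∀ m n p q → + m - + n ≡ + p - + q → m + q ≡ p + n
m-n≡p-q⇒m+q≡p+n m n p q eq = +-injective (begin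
  + m ℤ.+ + q                     ≡⟨ add-sub (+ m) (+ n) (+ q) ⟩
  (+ m - + n) ℤ.+ (+ n ℤ.+ + q)   ≡⟨ cong (ℤ._+ (+ n ℤ.+ + q)) eq ⟩
  (+ p - + q) ℤ.+ (+ n ℤ.+ + q)   ≡⟨ sub-add (+ p) (+ q) (+ n) ⟩
  + p ℤ.+ + n                     ∎)
  where
  add-sub : ∀ x y z → x ℤ.+ z ≡ (x - y) ℤ.+ (y ℤ.+ z)
  add-sub = solve-∀
  sub-add : ∀ x y z → (x - y) ℤ.+ (z ℤ.+ y) ≡ x ℤ.+ z
  sub-add = solve-∀

+-cancel-cross : ∀ {x₁ b₁ a₁ x₂ b₂ a₂} →
  x₁ + b₁ ≡ a₁ → x₂ + b₂ ≡ a₂ → a₁ + b₂ ≡ a₂ + b₁ → x₁ ≡ x₂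
+-cancel-cross {x₁} {b₁} {a₁} {x₂} {b₂} {a₂} eq₁ eq₂ eq = +-cancelʳ-≡ (b₁ + b₂) x₁ x₂ (begin
  x₁ + (b₁ + b₂)    ≡⟨ +-assoc x₁ b₁ b₂ ⟨
  x₁ + b₁ + b₂      ≡⟨ cong (_+ b₂) eq₁ ⟩
  a₁ + b₂           ≡⟨ eq ⟩
  a₂ + b₁           ≡⟨ cong (_+ b₁) eq₂ ⟨
  x₂ + b₂ + b₁      ≡⟨ +-assoc x₂ b₂ b₁ ⟩
  x₂ + (b₂ + b₁)    ≡⟨ cong (_+_ x₂) (+-comm b₂ b₁) ⟩
  x₂ + (b₁ + b₂)    ∎)

corollary5p3 : (n : ℕ) → 1 ≤ n → (Δ₁ Δ₂ : Family n)
    → IsProperIdeal Δ₁ → IsProperIdeal Δ₂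
    → (∀ (i : ℕ) → i ≤ n
        → (+ fΔ i Δ₁) - (+ fΔ (n ∸ i) Δ₁) ≡ (+ fΔ i Δ₂) - (+ fΔ (n ∸ i) Δ₂))
    → ∀ (j : ℕ) → fBier j Δ₁ ≡ fBier j Δ₂
corollary5p3 n _ Δ₁ Δ₂ I₁ I₂ same-differences j =
  +-cancel-cross (bier-face-identity (down-closed I₁) j) (bier-face-identity (down-closed I₂) j)
    (∑-*ʳ-cross (upTo (suc n)) (λ i → extensions n i j)
       (λ i → fΔ i Δ₁) (λ i → fΔ (n ∸ i) Δ₂) (λ i → fΔ i Δ₂) (λ i → fΔ (n ∸ i) Δ₁)
       λ {i} i∈ → m-n≡p-q⇒m+q≡p+n (fΔ i Δ₁) (fΔ (n ∸ i) Δ₁) (fΔ i Δ₂) (fΔ (n ∸ i) Δ₂)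
                    (same-differences i (≤-pred (∈-upTo⁻ i∈))))
  where open IsProperIdeal
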